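{- Let $\mathcal{C}$ be a hereditary class of graphs. Then $\mathcal{C}$ is intersectionwise $\chi$-imposing if and only if $\mathcal{C}$ is colorable, i.e. there is an integer $k$ such that $\chi(G)\le k$ for every $G\in\mathcal{C}$.
   Context: All graphs are finite, simple and undirected; all graph classes are hereditary (closed under isomorphism and induced subgraphs). The intersection of graphs $G_1,\dots,G_k$ is the graph $(\bigcap_{i} V(G_i),\bigcap_i E(G_i))$. For graph classes $\mathcal{G}_1,\dots,\mathcal{G}_k$, their graph-intersection is the class of all graphs $G$ such that $G=G_1\cap\dots\cap G_k$ for some $G_i\in\mathcal{G}_i$ ($i\in[k]$). A class $\mathcal{D}$ is $\chi$-bounded if there is a non-decreasing function $f:\mathbb{N}\to\mathbb{N}$ with $\chi(G)\le f(\omega(G))$ for all $G\in\mathcal{D}$. A class $\mathcal{A}$ is intersectionwise $\chi$-imposing if for every class of graphs $\mathcal{B}$ the graph-intersection of $\mathcal{A}$ and $\mathcal{B}$ is $\chi$-bounded. -}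

module Defs where

open import Data.Nat using (ℕ; suc; _≤_)
open import Data.Fin using (Fin)
open import Data.Bool using (Bool; true; false; _∧_)
open import Data.Product using (Σ; ∃; _×_)
open import Relation.Binary.PropositionalEquality using (_≡_; _≢_)
open import Relation.Nullary using (¬_)
open import Function.Definitions using (Injective)

record GraphOn (n : ℕ) : Set where
  field
    adj    : Fin n → Fin n → Bool
    sym    : ∀ i j → adj i j ≡ adj j i
    irrefl : ∀ i → adj i i ≡ false
open GraphOn public

Graph : Set
Graph = Σ ℕ GraphOn

GraphClass : Set₁
GraphClass = Graph → Set

-- Hereditary: closed under isomorphism and induced subgraphs.  H is
-- isomorphic to an induced subgraph of G iff there is an injection
-- ι : V(H) → V(G) with adj_H i j = adj_G (ι i) (ι j).
Hereditary : GraphClass → Set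
Hereditary C =
  ∀ {m n} (G : GraphOn n) (H : GraphOn m) (ι : Fin m → Fin n) →
  Injective _≡_ _≡_ ι →
  (∀ i j → adj H i j ≡ adj G (ι i) (ι j)) →
  C (n Data.Product., G) → C (m Data.Product., H)

ProperColouring : ∀ {n} → GraphOn n → ℕ → Set
ProperColouring {n} G k =
  Σ (Fin n → Fin k) λ c → ∀ i j → adj G i j ≡ true → c i ≢ c j

HasClique : ∀ {n} → GraphOn n → ℕ → Set
HasClique {n} G s =
  Σ (Fin s → Fin n) λ f →
    Injective _≡_ _≡_ f × (∀ i j → i ≢ j → adj G (f i) (f j) ≡ true)

CliqueNumber : ∀ {n} → GraphOn n → ℕ → Set
CliqueNumber G w = HasClique G w × ¬ HasClique G (suc w)

ChiBounded : GraphClass → Set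
ChiBounded D =
  Σ (ℕ → ℕ) λ f →
    (∀ a b → a ≤ b → f a ≤ f b) ×
    (∀ n (G : GraphOn n) → D (n Data.Product., G) →
       ∀ w → CliqueNumber G w → ProperColouring G (f w))

GraphIntersection : GraphClass → GraphClass → GraphClass
GraphIntersection A B (n Data.Product., G) =
  Σ (GraphOn n) λ G₁ → Σ (GraphOn n) λ G₂ →
    A (n Data.Product., G₁) × B (n Data.Product., G₂) ×
    (∀ i j → adj G i j ≡ (adj G₁ i j ∧ adj G₂ i j))

IntersectionwiseChiImposing : GraphClass → Set₁
IntersectionwiseChiImposing A =
  (B : GraphClass) → Hereditary B → ChiBounded (GraphIntersection A B)

Colorable : GraphClass → Set
Colorable C = Σ ℕ λ k → ∀ n (G : GraphOn n) → C (n Data.Product., G) → ProperColouring G k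

-- If every graph in C is k-colourable, so is every G₁ ∩ G₂ with G₁ ∈ C, being a
-- spanning subgraph of G₁.  Conversely, the intersection of C with the
-- triangle-free graphs is χ-bounded, so its members are k-colourable for some k.
-- The Mycielski graph M_k is triangle-free with χ(M_k) > k.  If some member of C
-- had a clique on |V(M_k)| vertices, heredity would put the complete graph K on
-- V(M_k) into C, and M_k = K ∩ M_k would lie in that intersection.  Hence C has
-- bounded clique number, and since G = G ∩ G exhibits C inside its intersection
-- with the class of all graphs, χ-boundedness of the latter colours C.
module Submission where

open import Defs hiding (sym)
open import Data.Bool using (Bool; true; false; _∧_)
open import Data.Bool.Properties using (∧-conicalˡ; ∧-idem; ∧-zeroʳ) renaming (_≟_ to _≟ᴮ_)
open import Data.Fin using (Fin; zero; suc; splitAt; _↑ˡ_; _↑ʳ_; punchOut; inject≤; finToFun; funToFin)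
open import Data.Fin.Properties
  using (_≟_; any?; all?; splitAt-↑ˡ; splitAt-↑ʳ; punchOut-injective; inject≤-injective; finToFun-funToFin)
open import Data.Nat using (ℕ; zero; suc; _+_; _≤_; _<_)
open import Data.Nat.Properties using (≤-refl; <⇒≤; m≤n⇒m≤1+n)
open import Data.Product using (∃-syntax; _×_; _,_)
open import Data.Sum using ([_,_])
open import Data.Unit using (⊤; tt)
open import Function using (_∘_)
open import Function.Definitions using (Injective)
open import Relation.Binary.PropositionalEquality using (_≡_; _≢_; _≗_; refl; sym; trans; cong; subst₂)
open import Relation.Nullary using (¬_; Dec; yes; no; contradiction)
open import Relation.Nullary.Decidable using (¬?; _→-dec_; decidable-stable)

private
  variable
    m n k s : ℕ

IsClique : GraphOn n → (Fin s → Fin n) → Set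
IsClique G f = ∀ i j → i ≢ j → adj G (f i) (f j) ≡ true

isClique⇒injective : (G : GraphOn n) {f : Fin s → Fin n} → IsClique G f → Injective _≡_ _≡_ f
isClique⇒injective G {f} clique {i} {j} fi≡fj = decidable-stable (i ≟ j) λ i≢j →
  contradiction (trans (sym (clique i j i≢j)) (trans (cong (adj G (f i)) (sym fi≡fj)) (irrefl G (f i))))
                λ ()

isClique⇒hasClique : (G : GraphOn n) {f : Fin s → Fin n} → IsClique G f → HasClique G s
isClique⇒hasClique G {f} clique = f , isClique⇒injective G clique , clique

isClique? : (G : GraphOn n) (f : Fin s → Fin n) → Dec (IsClique G f)
isClique? G f = all? λ i → all? λ j → ¬? (i ≟ j) →-dec (adj G (f i) (f j) ≟ᴮ true)

isClique-resp-≗ : (G : GraphOn n) {f g : Fin s → Fin n} → f ≗ g → IsClique G f → IsClique G g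
isClique-resp-≗ G f≗g clique i j i≢j =
  subst₂ (λ a b → adj G a b ≡ true) (f≗g i) (f≗g j) (clique i j i≢j)

hasClique? : (G : GraphOn n) (s : ℕ) → Dec (HasClique G s)
hasClique? {n} G s with any? (λ code → isClique? G (finToFun {n} {s} code))
... | yes (code , clique) = yes (isClique⇒hasClique G clique)
... | no noClique = no λ (f , _ , clique) →
  noClique (funToFin f , isClique-resp-≗ G (sym ∘ finToFun-funToFin f) clique)

cliqueNumber-< : (G : GraphOn n) → ¬ HasClique G s → ∃[ w ] w < s × CliqueNumber G w
cliqueNumber-< {s = zero} G noClique = contradiction (isClique⇒hasClique G {f = λ ()} (λ ())) noClique
cliqueNumber-< {s = suc s} G noClique with hasClique? G s
... | yes clique = s , ≤-refl , clique , noClique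
... | no noSmaller with cliqueNumber-< G noSmaller
...   | w , w<s , ω≡w = w , m≤n⇒m≤1+n w<s , ω≡w

properColouring-mono : (G : GraphOn n) → k ≤ m → ProperColouring G k → ProperColouring G m
properColouring-mono G k≤m (c , proper) =
  (λ i → inject≤ (c i) k≤m) , λ i j e → proper i j e ∘ inject≤-injective _ _ (c i) (c j)

properColouring-subgraph : (G H : GraphOn n) → (∀ i j → adj H i j ≡ true → adj G i j ≡ true) →
  ProperColouring G k → ProperColouring H k
properColouring-subgraph G H H⊆G (c , proper) = c , λ i j e → proper i j (H⊆G i j e)

induced : GraphOn n → (Fin m → Fin n) → GraphOn m
induced G ι = record
  { adj    = λ i j → adj G (ι i) (ι j)
  ; sym    = λ i j → GraphOn.sym G (ι i) (ι j)
  ; irrefl = λ i → irrefl G (ι i)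
  }

hereditary-induced : (C : GraphClass) → Hereditary C → (G : GraphOn n) {ι : Fin m → Fin n} →
  Injective _≡_ _≡_ ι → C (n , G) → C (m , induced G ι)
hereditary-induced C hC G {ι} ι-injective = hC G (induced G ι) ι ι-injective (λ _ _ → refl)

∩-complete : (G K : GraphOn n) → (∀ i j → i ≢ j → adj K i j ≡ true) →
  ∀ i j → adj G i j ≡ (adj K i j ∧ adj G i j)
∩-complete G K complete i j with i ≟ j
... | yes refl rewrite irrefl G i = sym (∧-zeroʳ (adj K i i))
... | no i≢j = cong (_∧ adj G i j) (sym (complete i j i≢j))

Triangle : GraphOn n → Set
Triangle G = ∃[ a ] ∃[ b ] ∃[ c ]
  adj G a b ≡ true × adj G a c ≡ true × adj G b c ≡ true

hasClique⇒triangle : (G : GraphOn n) → HasClique G 3 → Triangle G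
hasClique⇒triangle G (f , _ , clique) =
  f zero , f one , f two , clique zero one (λ ()) , clique zero two (λ ()) , clique one two (λ ())
  where
  one two : Fin 3
  one = suc zero
  two = suc (suc zero)

TriangleFree : GraphClass
TriangleFree (_ , G) = ¬ Triangle G

triangleFree-hereditary : Hereditary TriangleFree
triangleFree-hereditary G H ι _ H≡G∘ι G-triangleFree (a , b , c , ab , ac , bc) =
  G-triangleFree (ι a , ι b , ι c , edge a b ab , edge a c ac , edge b c bc)
  where
  edge : ∀ x y → adj H x y ≡ true → adj G (ι x) (ι y) ≡ true
  edge x y = trans (sym (H≡G∘ι x y))

AllGraphs : GraphClass
AllGraphs _ = ⊤

allGraphs-hereditary : Hereditary AllGraphs
allGraphs-hereditary _ _ _ _ _ _ = tt

data MycielskiVertex (n : ℕ) : Set where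
  apex   : MycielskiVertex n
  orig   : Fin n → MycielskiVertex n
  shadow : Fin n → MycielskiVertex n

fromFin : Fin (suc (n + n)) → MycielskiVertex n
fromFin zero        = apex
fromFin {n} (suc x) = [ orig , shadow ] (splitAt n x)

toFin : MycielskiVertex n → Fin (suc (n + n))
toFin apex           = zero
toFin {n} (orig i)   = suc (i ↑ˡ n)
toFin {n} (shadow i) = suc (n ↑ʳ i)

fromFin-toFin : (x : MycielskiVertex n) → fromFin (toFin x) ≡ x
fromFin-toFin apex                                      = refl
fromFin-toFin {n} (orig i) rewrite splitAt-↑ˡ n i n     = refl
fromFin-toFin {n} (shadow i) rewrite splitAt-↑ʳ n n i   = refl

mycielskiAdj : GraphOn n → MycielskiVertex n → MycielskiVertex n → Bool
mycielskiAdj G (orig i)   (orig j)   = adj G i j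
mycielskiAdj G (orig i)   (shadow j) = adj G i j
mycielskiAdj G (shadow i) (orig j)   = adj G i j
mycielskiAdj G apex       (shadow _) = true
mycielskiAdj G (shadow _) apex       = true
mycielskiAdj G _          _          = false

mycielskiAdj-sym : (G : GraphOn n) → ∀ x y → mycielskiAdj G x y ≡ mycielskiAdj G y x
mycielskiAdj-sym G apex       apex       = refl
mycielskiAdj-sym G apex       (orig _)   = refl
mycielskiAdj-sym G apex       (shadow _) = refl
mycielskiAdj-sym G (orig _)   apex       = refl
mycielskiAdj-sym G (orig i)   (orig j)   = GraphOn.sym G i j
mycielskiAdj-sym G (orig i)   (shadow j) = GraphOn.sym G i j
mycielskiAdj-sym G (shadow _) apex       = refl
mycielskiAdj-sym G (shadow i) (orig j)   = GraphOn.sym G i j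
mycielskiAdj-sym G (shadow _) (shadow _) = refl

mycielskiAdj-irrefl : (G : GraphOn n) → ∀ x → mycielskiAdj G x x ≡ false
mycielskiAdj-irrefl G apex       = refl
mycielskiAdj-irrefl G (orig i)   = irrefl G i
mycielskiAdj-irrefl G (shadow _) = refl

mycielskian : GraphOn n → GraphOn (suc (n + n))
mycielskian G = record
  { adj    = λ x y → mycielskiAdj G (fromFin x) (fromFin y)
  ; sym    = λ x y → mycielskiAdj-sym G (fromFin x) (fromFin y)
  ; irrefl = λ x → mycielskiAdj-irrefl G (fromFin x)
  }

mycielskian-adj-toFin : (G : GraphOn n) → ∀ x y →
  adj (mycielskian G) (toFin x) (toFin y) ≡ mycielskiAdj G x y
mycielskian-adj-toFin G x y rewrite fromFin-toFin x | fromFin-toFin y = refl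

mycielskiAdj-triangle : (G : GraphOn n) → ∀ x y z →
  mycielskiAdj G x y ≡ true → mycielskiAdj G x z ≡ true → mycielskiAdj G y z ≡ true → Triangle G
mycielskiAdj-triangle G (orig i)   (orig j)   (orig k)   ij ik jk = i , j , k , ij , ik , jk
mycielskiAdj-triangle G (orig i)   (orig j)   (shadow k) ij ik jk = i , j , k , ij , ik , jk
mycielskiAdj-triangle G (orig i)   (shadow j) (orig k)   ij ik jk = i , j , k , ij , ik , jk
mycielskiAdj-triangle G (shadow i) (orig j)   (orig k)   ij ik jk = i , j , k , ij , ik , jk
mycielskiAdj-triangle G apex       apex       _          ()
mycielskiAdj-triangle G apex       (orig _)   _          ()
mycielskiAdj-triangle G apex       (shadow _) apex       _  ()
mycielskiAdj-triangle G apex       (shadow _) (orig _)   _  ()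
mycielskiAdj-triangle G apex       (shadow _) (shadow _) _  _  ()
mycielskiAdj-triangle G (orig _)   apex       _          ()
mycielskiAdj-triangle G (orig _)   _          apex       _  ()
mycielskiAdj-triangle G (orig _)   (shadow _) (shadow _) _  _  ()
mycielskiAdj-triangle G (shadow _) apex       (orig _)   _  _  ()
mycielskiAdj-triangle G (shadow _) _          (shadow _) _  ()
mycielskiAdj-triangle G (shadow _) (orig _)   apex       _  _  ()
mycielskiAdj-triangle G (shadow _) (shadow _) _          ()
mycielskiAdj-triangle G (shadow _) apex       apex       _  _  ()

mycielskian-triangle : (G : GraphOn n) → Triangle (mycielskian G) → Triangle G
mycielskian-triangle G (x , y , z , xy , xz , yz) =
  mycielskiAdj-triangle G (fromFin x) (fromFin y) (fromFin z) xy xz yz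

-- An original vertex with the apex's colour takes its shadow's colour instead;
-- the apex's colour is then unused on the original vertices and is punched out.
mycielskian-colouring : (G : GraphOn n) → ProperColouring (mycielskian G) (suc k) → ProperColouring G k
mycielskian-colouring {n} {k} G (c , proper) =
  (λ i → punchOut (apex≢recolour i)) ,
  λ i j e → recolour-proper i j e ∘ punchOut-injective (apex≢recolour i) (apex≢recolour j)
  where
  colour : MycielskiVertex n → Fin (suc k)
  colour x = c (toFin x)

  colour-proper : ∀ x y → mycielskiAdj G x y ≡ true → colour x ≢ colour y
  colour-proper x y e = proper (toFin x) (toFin y) (trans (mycielskian-adj-toFin G x y) e)

  recolour : Fin n → Fin (suc k)
  recolour i with colour (orig i) ≟ colour apex
  ... | yes _ = colour (shadow i)
  ... | no _  = colour (orig i)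

  apex≢recolour : ∀ i → colour apex ≢ recolour i
  apex≢recolour i with colour (orig i) ≟ colour apex
  ... | yes _      = colour-proper apex (shadow i) refl
  ... | no i≢apex  = i≢apex ∘ sym

  recolour-proper : ∀ i j → adj G i j ≡ true → recolour i ≢ recolour j
  recolour-proper i j e with colour (orig i) ≟ colour apex | colour (orig j) ≟ colour apex
  ... | yes i≡apex | yes j≡apex = λ _ → colour-proper (orig i) (orig j) e (trans i≡apex (sym j≡apex))
  ... | yes _      | no _       = colour-proper (shadow i) (orig j) e
  ... | no _       | yes _      = colour-proper (orig i) (shadow j) e
  ... | no _       | no _       = colour-proper (orig i) (orig j) e

K₁ : GraphOn 1
K₁ = record { adj = λ _ _ → false ; sym = λ _ _ → refl ; irrefl = λ _ → refl }

mycielskiOrder : ℕ → ℕ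
mycielskiOrder zero    = 1
mycielskiOrder (suc t) = suc (mycielskiOrder t + mycielskiOrder t)

mycielskiGraph : (t : ℕ) → GraphOn (mycielskiOrder t)
mycielskiGraph zero    = K₁
mycielskiGraph (suc t) = mycielskian (mycielskiGraph t)

mycielskiGraph-triangleFree : ∀ t → ¬ Triangle (mycielskiGraph t)
mycielskiGraph-triangleFree zero    (_ , _ , _ , () , _)
mycielskiGraph-triangleFree (suc t) = mycielskiGraph-triangleFree t ∘ mycielskian-triangle (mycielskiGraph t)

mycielskiGraph-not-colourable : ∀ t → ¬ ProperColouring (mycielskiGraph t) t
mycielskiGraph-not-colourable zero    (c , _) with c zero
... | ()
mycielskiGraph-not-colourable (suc t) =
  mycielskiGraph-not-colourable t ∘ mycielskian-colouring (mycielskiGraph t)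

chiBounded⇒colourable-without-clique : (D : GraphClass) → ChiBounded D → ∀ s →
  ∃[ k ] ∀ n (G : GraphOn n) → D (n , G) → ¬ HasClique G s → ProperColouring G k
chiBounded⇒colourable-without-clique D (f , f-mono , f-bound) s = f s , colour
  where
  colour : ∀ n (G : GraphOn n) → D (n , G) → ¬ HasClique G s → ProperColouring G (f s)
  colour n G G∈D noClique with cliqueNumber-< G noClique
  ... | w , w<s , ω≡w = properColouring-mono G (f-mono w s (<⇒≤ w<s)) (f-bound n G G∈D w ω≡w)

CliqueBounded : GraphClass → Set
CliqueBounded C = ∃[ s ] ∀ n (G : GraphOn n) → C (n , G) → ¬ HasClique G s

chiBounded-∩-triangleFree⇒cliqueBounded : (C : GraphClass) → Hereditary C →
  ChiBounded (GraphIntersection C TriangleFree) → CliqueBounded C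
chiBounded-∩-triangleFree⇒cliqueBounded C hC χ-bounded with chiBounded⇒colourable-without-clique _ χ-bounded 3
... | k , colour = mycielskiOrder k , λ n G G∈C (ι , ι-injective , ι-clique) →
  let M = mycielskiGraph k
      M-triangleFree = mycielskiGraph-triangleFree k
  in mycielskiGraph-not-colourable k
       (colour _ M (induced G ι , M , hereditary-induced C hC G ι-injective G∈C , M-triangleFree ,
                    ∩-complete M (induced G ι) ι-clique)
               (M-triangleFree ∘ hasClique⇒triangle M))

cliqueBounded⇒colorable : (C : GraphClass) → CliqueBounded C →
  ChiBounded (GraphIntersection C AllGraphs) → Colorable C
cliqueBounded⇒colorable C (s , noClique) χ-bounded with chiBounded⇒colourable-without-clique _ χ-bounded s
... | k , colour = k , λ n G G∈C →
  colour n G (G , G , G∈C , tt , λ i j → sym (∧-idem (adj G i j))) (noClique n G G∈C)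

colorable⇒intersectionwiseChiImposing : (C : GraphClass) → Colorable C → IntersectionwiseChiImposing C
colorable⇒intersectionwiseChiImposing C (k , colour) B _ = (λ _ → k) , (λ _ _ _ → ≤-refl) , colour-∩
  where
  colour-∩ : ∀ n (G : GraphOn n) → GraphIntersection C B (n , G) → ∀ w → CliqueNumber G w → ProperColouring G k
  colour-∩ n G (G₁ , G₂ , G₁∈C , _ , G≡G₁∩G₂) _ _ = properColouring-subgraph G₁ G
    (λ i j e → ∧-conicalˡ _ _ (trans (sym (G≡G₁∩G₂ i j)) e)) (colour n G₁ G₁∈C)

theorem2p1 : (C : GraphClass) → Hereditary C →
    (IntersectionwiseChiImposing C → Colorable C) × (Colorable C → IntersectionwiseChiImposing C)
theorem2p1 C hC = imposing⇒colorable , colorable⇒intersectionwiseChiImposing C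
  where
  imposing⇒colorable : IntersectionwiseChiImposing C → Colorable C
  imposing⇒colorable imposing = cliqueBounded⇒colorable C
    (chiBounded-∩-triangleFree⇒cliqueBounded C hC (imposing TriangleFree triangleFree-hereditary))
    (imposing AllGraphs allGraphs-hereditary)
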